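{- Let $\tau=\tau^1\mbox{ - }\tau^2\mbox{ - }\cdots\mbox{ - }\tau^s$ be a multi-pattern, where each $\tau^i$ is a non-empty generalized pattern with no hyphens. Then for $k\ge1$, $$A_\tau(x;k)=\sum_{j=1}^s A_{\tau^j}(x;k)\prod_{i=1}^{j-1}\bigl((kx-1)A_{\tau^i}(x;k)+1\bigr).$$
   Context: $[k]^n$ = words of length $n$ over $\{1,\dots,k\}$. A generalized pattern with no hyphens is a word over $[m]$ using every letter of $[m]$; a word contains it if some factor of consecutive letters is order-isomorphic to it (relations $<,=,>$ preserved between all pairs of positions). A multi-pattern $\tau^1\mbox{ - }\cdots\mbox{ - }\tau^s$ is the concatenation of the blocks with hyphens between them, where letters of different blocks are incomparable; a word $\sigma$ contains it if $\sigma$ has occurrences of $\tau^1,\dots,\tau^s$ in this left-to-right order, pairwise non-overlapping; otherwise $\sigma$ avoids it. For any such pattern $\pi$, $A_\pi(x;k)=\sum_{n\ge0}a_\pi(n;k)x^n$ with $a_\pi(n;k)$ the number of words in $[k]^n$ avoiding $\pi$ ($a_\pi(0;k)=1$). -}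

module Defs where

open import Data.Nat using (ℕ; zero; suc; _≤_; _<_)
open import Data.Nat.Properties using (<⇒≤)
open import Data.Integer as ℤ using (ℤ; +_)
open import Data.Fin using (Fin; toℕ; inject≤; cast)
import Data.Fin as F
open import Data.Fin.Properties using (toℕ<n)
open import Data.List using (List; []; _∷_; _++_; length; lookup)
open import Data.List.Relation.Unary.All using (All)
open import Data.List.Relation.Unary.Unique.Propositional using (Unique)
open import Data.List.Membership.Propositional using (_∈_)
open import Data.Product using (Σ; ∃; _×_)
open import Data.Unit using (⊤)
open import Relation.Nullary using (¬_)
open import Relation.Binary.PropositionalEquality using (_≡_)
open import Function.Bundles using (_⇔_)

InWords : ℕ → ℕ → List ℕ → Set
InWords k n w = length w ≡ n × All (λ a → 1 ≤ a × a ≤ k) w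

-- a generalized pattern with no hyphens: a word over [m] using every
-- letter of [m], for some m
IsPattern : List ℕ → Set
IsPattern p = Σ ℕ λ m → All (λ a → 1 ≤ a × a ≤ m) p
                       × (∀ a → 1 ≤ a → a ≤ m → a ∈ p)

OrderIso : List ℕ → List ℕ → Set
OrderIso u v = Σ (length u ≡ length v) λ eq → ∀ (i j : Fin (length u)) →
    (lookup u i < lookup u j ⇔ lookup v (cast eq i) < lookup v (cast eq j))
  × (lookup u i ≡ lookup u j ⇔ lookup v (cast eq i) ≡ lookup v (cast eq j))

-- w contains the multi-pattern τ¹-τ²-…-τˢ (given as the list of blocks):
-- w = u₁ f₁ u₂ f₂ … fₛ v with each factor fᵢ order-isomorphic to τⁱ
-- (occurrences in left-to-right order, pairwise non-overlapping).
ContainsMulti : List (List ℕ) → List ℕ → Set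
ContainsMulti []       w = ⊤
ContainsMulti (τ ∷ τs) w =
  ∃ λ u → ∃ λ f → ∃ λ v → w ≡ u ++ f ++ v × OrderIso f τ × ContainsMulti τs v

Contains : List ℕ → List ℕ → Set
Contains τ w = ∃ λ u → ∃ λ f → ∃ λ v → w ≡ u ++ f ++ v × OrderIso f τ

-- c = number of words w ∈ [k]^n satisfying P  (cardinality of a finite set:
-- a duplicate-free list enumerating exactly these words has length c)
IsCount : (List ℕ → Set) → ℕ → ℕ → ℕ → Set
IsCount P k n c = Σ (List (List ℕ)) λ L →
    Unique L
  × (∀ w → w ∈ L → InWords k n w × P w)
  × (∀ w → InWords k n w → P w → w ∈ L)
  × length L ≡ c

PS : Set
PS = ℕ → ℤ

_≋_ : PS → PS → Set
f ≋ g = ∀ n → f n ≡ g n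

0ps : PS
0ps _ = + 0

1ps : PS
1ps zero    = + 1
1ps (suc _) = + 0

kx-1 : ℕ → PS
kx-1 k zero          = ℤ.- (+ 1)
kx-1 k (suc zero)    = + k
kx-1 k (suc (suc _)) = + 0

_⊕_ : PS → PS → PS
(f ⊕ g) n = f n ℤ.+ g n

-- Σ_{i=0}^{n} f(i) g(n-i)
conv : PS → PS → ℕ → ℕ → ℤ
conv f g zero    m = f zero ℤ.* g m
conv f g (suc i) m = f (suc i) ℤ.* g m ℤ.+ conv f g i (suc m)

_⊗_ : PS → PS → PS
(f ⊗ g) n = conv f g n 0

ΣPS : (s : ℕ) → (Fin s → PS) → PS
ΣPS zero    G = 0ps
ΣPS (suc s) G = G F.zero ⊕ ΣPS s (λ i → G (F.suc i))

ΠPS : (s : ℕ) → (Fin s → PS) → PS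
ΠPS zero    G = 1ps
ΠPS (suc s) G = G F.zero ⊗ ΠPS s (λ i → G (F.suc i))

GF : (ℕ → ℕ) → PS
GF a n = + (a n)

-- the right-hand side  Σ_{j=1}^{s} A_j ∏_{i=1}^{j-1} ((kx−1) A_i + 1)
-- (0-indexed here: j ∈ Fin s, i ranges over indices < j)
RHS : (k s : ℕ) → (Fin s → PS) → PS
RHS k s A = ΣPS s λ j → A j ⊗ ΠPS (toℕ j) λ i →
  ((kx-1 k ⊗ A (inject≤ i (<⇒≤ (toℕ<n j)))) ⊕ 1ps)

{-# OPTIONS --safe #-}
-- Let b(m) count the words of length m avoiding τ¹.  A word avoids τ¹-τ²-⋯-τˢ iff it avoids
-- τ¹, or it is u v where u is its shortest prefix containing τ¹ and v avoids τ²-⋯-τˢ.  The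
-- words u of length m whose first occurrence of τ¹ ends at their last letter number
-- c(m) = k b(m-1) - b(m) and c(0) = 0 = 1 - b(0), so Σ c(m) xᵐ = (kx-1) A_{τ¹} + 1 and
-- A_τ = A_{τ¹} + ((kx-1) A_{τ¹} + 1) A_{τ²-⋯-τˢ}; unfolding this recursion over the blocks gives
-- the sum.
module Submission where

open import Defs
open import Data.Nat using (ℕ; zero; suc; _+_; _*_; _∸_; _≤_; _≥_; _<_; z≤n; s≤s)
import Data.Nat.Properties as ℕP
open import Data.Integer as ℤ using (ℤ; +_)
import Data.Integer.Properties as ℤP
open import Data.Integer.Tactic.RingSolver using (solve-∀)
open import Data.Fin using (Fin; toℕ; zero; suc)
open import Data.Fin.Properties using (toℕ<n)
open import Data.List using (List; []; _∷_; _++_; length; take; drop)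
import Data.List.Properties as List
open import Data.List.Relation.Unary.All using (All; []; _∷_)
open import Data.List.Relation.Unary.All.Properties using (take⁺; drop⁺; All¬⇒¬Any)
open import Data.List.Relation.Unary.AllPairs using ([]; _∷_)
open import Data.List.Relation.Unary.Any using (here; there)
open import Data.List.Relation.Unary.Unique.Propositional using (Unique)
open import Data.Product using (Σ-syntax; ∃₂; _×_; _,_; proj₁; proj₂)
open import Data.Sum using (_⊎_; inj₁; inj₂)
open import Data.Unit using (tt)
open import Data.Vec.Functional using (toList)
open import Function using (_∘_; _⇔_; mk⇔; Equivalence)
open import Function.Related.TypeIsomorphisms using (¬-cong-⇔)
open import Relation.Binary.Core using (_Preserves_⟶_)
open import Relation.Nullary using (¬_; Dec; yes; no; contradiction)
open import Relation.Binary.PropositionalEquality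
open import Algebra.Properties.Semiring.Sum ℕP.+-*-semiring
  using (sum-syntax; ∑-distrib-+; *-distribˡ-sum; *-distribʳ-sum; sum-cong-≗; sum-replicate-zero)

infix 4 _≟ʷ_
_≟ʷ_ : (u v : List ℕ) → Dec (u ≡ v)
_≟ʷ_ = List.≡-dec ℕP._≟_

open import Data.List.Membership.DecPropositional _≟ʷ_ using (_∈_; _∈?_)

∑< : ℕ → (ℕ → ℕ) → ℕ
∑< n f = ∑[ i < n ] f (toℕ i)

∑<-cong : ∀ n {f g : ℕ → ℕ} → (∀ i → i < n → f i ≡ g i) → ∑< n f ≡ ∑< n g
∑<-cong n f≡g = sum-cong-≗ λ i → f≡g (toℕ i) (toℕ<n i)

∑<-zero : ∀ n {f : ℕ → ℕ} → (∀ i → i < n → f i ≡ 0) → ∑< n f ≡ 0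
∑<-zero n f≡0 = trans (∑<-cong n f≡0) (sum-replicate-zero n)

∑<-distrib-+ : ∀ n (f g : ℕ → ℕ) → ∑< n (λ i → f i + g i) ≡ ∑< n f + ∑< n g
∑<-distrib-+ n f g = ∑-distrib-+ {n} (f ∘ toℕ) (g ∘ toℕ)

∑<-*ˡ : ∀ n c (f : ℕ → ℕ) → ∑< n (λ i → c * f i) ≡ c * ∑< n f
∑<-*ˡ n c f = sym (*-distribˡ-sum {n} c (f ∘ toℕ))

∑<-*ʳ : ∀ n c (f : ℕ → ℕ) → ∑< n (λ i → f i * c) ≡ ∑< n f * c
∑<-*ʳ n c f = sym (*-distribʳ-sum {n} c (f ∘ toℕ))

∑<-const : ∀ n x → ∑< n (λ _ → x) ≡ n * x
∑<-const zero    x = refl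
∑<-const (suc n) x = cong (_+_ x) (∑<-const n x)

∑<-δ : ∀ n i {f : ℕ → ℕ} → i < n → (∀ j → j < n → j ≢ i → f j ≡ 0) → ∑< n f ≡ f i
∑<-δ (suc n) zero {f} _ others =
  trans (cong (_+_ (f 0)) (∑<-zero n λ j j<n → others (suc j) (s≤s j<n) λ ()))
        (ℕP.+-identityʳ (f 0))
∑<-δ (suc n) (suc i) (s≤s i<n) others =
  cong₂ _+_ (others 0 (s≤s z≤n) λ ())
            (∑<-δ n i i<n λ j j<n j≢i → others (suc j) (s≤s j<n) (j≢i ∘ ℕP.suc-injective))

Indicator : Set → ℕ → Set
Indicator P x = (P × x ≡ 1) ⊎ (¬ P × x ≡ 0)

indicator : {P : Set} → Dec P → ℕ
indicator (yes _) = 1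
indicator (no _)  = 0

indicator-Indicator : ∀ {P} (p? : Dec P) → Indicator P (indicator p?)
indicator-Indicator (yes p) = inj₁ (p , refl)
indicator-Indicator (no ¬p) = inj₂ (¬p , refl)

module _ {P : Set} {x : ℕ} where

  Indicator-≤1 : Indicator P x → x ≤ 1
  Indicator-≤1 (inj₁ (_ , refl)) = s≤s z≤n
  Indicator-≤1 (inj₂ (_ , refl)) = z≤n

  Indicator-yes : Indicator P x → P → x ≡ 1
  Indicator-yes (inj₁ (_ , x≡1)) _ = x≡1
  Indicator-yes (inj₂ (¬p , _))  p = contradiction p ¬p

  Indicator-no : Indicator P x → ¬ P → x ≡ 0
  Indicator-no (inj₁ (p , _))  ¬p = contradiction p ¬p
  Indicator-no (inj₂ (_ , x≡0)) _ = x≡0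

  Indicator-≡0⇒¬ : Indicator P x → x ≡ 0 → ¬ P
  Indicator-≡0⇒¬ (inj₁ (_ , refl)) ()
  Indicator-≡0⇒¬ (inj₂ (¬p , _))   _ = ¬p

  Indicator-⇔ : ∀ {Q} → P ⇔ Q → Indicator P x → Indicator Q x
  Indicator-⇔ P⇔Q (inj₁ (p , x≡1))  = inj₁ (Equivalence.to P⇔Q p , x≡1)
  Indicator-⇔ P⇔Q (inj₂ (¬p , x≡0)) = inj₂ (¬p ∘ Equivalence.from P⇔Q , x≡0)

Indicator-unique : ∀ {P x y} → Indicator P x → Indicator P y → x ≡ y
Indicator-unique (inj₁ (p , x≡1))  P-y = trans x≡1 (sym (Indicator-yes P-y p))
Indicator-unique (inj₂ (¬p , x≡0)) P-y = trans x≡0 (sym (Indicator-no P-y ¬p))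

Word : ℕ → List ℕ → Set
Word k = All (λ a → 1 ≤ a × a ≤ k)

IndicatorOn : ℕ → (List ℕ → Set) → (List ℕ → ℕ) → Set
IndicatorOn k P χ = ∀ w → Word k w → Indicator (P w) (χ w)

module _ (k : ℕ) where

  count : (List ℕ → ℕ) → ℕ → ℕ
  count f zero    = f []
  count f (suc n) = ∑< k λ a → count (f ∘ (suc a ∷_)) n

  count-cong : ∀ n {f g} → (∀ w → InWords k n w → f w ≡ g w) → count f n ≡ count g n
  count-cong zero    f≡g = f≡g [] (refl , [])
  count-cong (suc n) f≡g = ∑<-cong k λ a a<k → count-cong n λ w (|w|≡n , w∈) →
    f≡g (suc a ∷ w) (cong suc |w|≡n , (s≤s z≤n , a<k) ∷ w∈)

  count-zero : ∀ n → count (λ _ → 0) n ≡ 0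
  count-zero zero    = refl
  count-zero (suc n) = ∑<-zero k λ _ _ → count-zero n

  count-+ : ∀ n f g → count (λ w → f w + g w) n ≡ count f n + count g n
  count-+ zero    f g = refl
  count-+ (suc n) f g =
    trans (∑<-cong k λ a _ → count-+ n (f ∘ (suc a ∷_)) (g ∘ (suc a ∷_)))
          (∑<-distrib-+ k (λ a → count (f ∘ (suc a ∷_)) n) (λ a → count (g ∘ (suc a ∷_)) n))

  count-*ˡ : ∀ n c f → count (λ w → c * f w) n ≡ c * count f n
  count-*ˡ zero    c f = refl
  count-*ˡ (suc n) c f =
    trans (∑<-cong k λ a _ → count-*ˡ n c (f ∘ (suc a ∷_)))
          (∑<-*ˡ k c λ a → count (f ∘ (suc a ∷_)) n)

  count-∑< : ∀ N n (h : ℕ → List ℕ → ℕ) →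
    count (λ w → ∑< N λ m → h m w) n ≡ ∑< N λ m → count (h m) n
  count-∑< zero    n h = count-zero n
  count-∑< (suc N) n h =
    trans (count-+ n (h 0) _) (cong (_+_ (count (h 0) n)) (count-∑< N n (h ∘ suc)))

  count-split : ∀ m r f g →
    count (λ w → f (take m w) * g (drop m w)) (m + r) ≡ count f m * count g r
  count-split zero    r f g = count-*ˡ r (f []) g
  count-split (suc m) r f g =
    trans (∑<-cong k λ a _ → count-split m r (f ∘ (suc a ∷_)) g)
          (∑<-*ʳ k (count g r) λ a → count (f ∘ (suc a ∷_)) m)

  count-≟ : ∀ n x → InWords k n x → count (λ w → indicator (w ≟ʷ x)) n ≡ 1
  count-≟ zero    []      _ = refl
  count-≟ (suc n) (zero  ∷ x) (_ , (() , _) ∷ _)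
  count-≟ (suc n) (suc c ∷ x) (|x|≡n , (_ , c<k) ∷ x∈) =
    trans (∑<-δ k c c<k other) (trans (count-cong n same) (count-≟ n x (ℕP.suc-injective |x|≡n , x∈)))
    where
    other : ∀ a → a < k → a ≢ c → count (λ w → indicator (suc a ∷ w ≟ʷ suc c ∷ x)) n ≡ 0
    other a _ a≢c = trans (count-cong n λ w _ → Indicator-no (indicator-Indicator _) (a≢c ∘ head-injective))
                          (count-zero n)
      where
      head-injective : ∀ {w} → suc a ∷ w ≡ suc c ∷ x → a ≡ c
      head-injective = ℕP.suc-injective ∘ List.∷-injectiveˡ
    same : ∀ w → InWords k n w → indicator (suc c ∷ w ≟ʷ suc c ∷ x) ≡ indicator (w ≟ʷ x)
    same w _ = Indicator-unique (indicator-Indicator _)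
      (Indicator-⇔ (mk⇔ (cong (suc c ∷_)) List.∷-injectiveʳ) (indicator-Indicator (w ≟ʷ x)))

  count-∈ : ∀ n L → Unique L → (∀ x → x ∈ L → InWords k n x) →
    count (λ w → indicator (w ∈? L)) n ≡ length L
  count-∈ n []      _           _  = count-zero n
  count-∈ n (x ∷ L) (x∉L ∷ L!) L⊆ = begin
      count (λ w → indicator (w ∈? x ∷ L)) n
    ≡⟨ count-cong n (λ w _ → split w (w ≟ʷ x)) ⟩
      count (λ w → indicator (w ≟ʷ x) + indicator (w ∈? L)) n
    ≡⟨ count-+ n _ _ ⟩
      count (λ w → indicator (w ≟ʷ x)) n + count (λ w → indicator (w ∈? L)) n
    ≡⟨ cong₂ _+_ (count-≟ n x (L⊆ x (here refl))) (count-∈ n L L! λ y → L⊆ y ∘ there) ⟩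
      suc (length L) ∎
    where
    open ≡-Reasoning
    split : ∀ w (w≟x : Dec (w ≡ x)) → indicator (w ∈? x ∷ L) ≡ indicator w≟x + indicator (w ∈? L)
    split w (yes refl) =
      trans (Indicator-yes (indicator-Indicator (w ∈? x ∷ L)) (here refl))
            (cong suc (sym (Indicator-no (indicator-Indicator (w ∈? L)) (All¬⇒¬Any x∉L))))
    split w (no w≢x) = Indicator-unique (indicator-Indicator (w ∈? x ∷ L))
      (Indicator-⇔ (mk⇔ there λ { (here w≡x) → contradiction w≡x w≢x ; (there w∈L) → w∈L })
                   (indicator-Indicator (w ∈? L)))

  IsCount-∈⇔ : ∀ {P n c} (H : IsCount P k n c) w → InWords k n w → w ∈ proj₁ H ⇔ P w
  IsCount-∈⇔ (_ , _ , L⊆ , ⊆L , _) w w∈ = mk⇔ (proj₂ ∘ L⊆ w) (⊆L w w∈)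

  count-Indicator : ∀ {P n c χ} → IsCount P k n c → (∀ w → InWords k n w → Indicator (P w) (χ w)) →
    count χ n ≡ c
  count-Indicator {n = n} {χ = χ} H@(L , L! , L⊆ , _ , |L|≡c) χ-ind =
    trans (count-cong n λ w w∈ → Indicator-unique (χ-ind w w∈)
                                   (Indicator-⇔ (IsCount-∈⇔ H w w∈) (indicator-Indicator (w ∈? L))))
          (trans (count-∈ n L L! λ x → proj₁ ∘ L⊆ x) |L|≡c)

  -- Containment is not known to be decidable; membership in the enumerating lists decides it.
  IsCount⇒IndicatorOn : ∀ {P} {c : ℕ → ℕ} → (∀ n → IsCount P k n (c n)) →
    Σ[ χ ∈ (List ℕ → ℕ) ] IndicatorOn k P χ × (∀ n → count χ n ≡ c n)
  IsCount⇒IndicatorOn {P} H = χ , χ-ind , λ n → count-Indicator (H n) λ w w∈ → χ-ind w (proj₂ w∈)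
    where
    χ : List ℕ → ℕ
    χ w = indicator (w ∈? proj₁ (H (length w)))
    χ-ind : IndicatorOn k P χ
    χ-ind w w∈ = Indicator-⇔ (IsCount-∈⇔ (H (length w)) w (refl , w∈)) (indicator-Indicator _)

shift : PS → PS
shift f n = f (suc n)

≋-refl : ∀ {f} → f ≋ f
≋-refl n = refl

≋-sym : ∀ {f g} → f ≋ g → g ≋ f
≋-sym f≋g n = sym (f≋g n)

≋-trans : ∀ {f g h} → f ≋ g → g ≋ h → f ≋ h
≋-trans f≋g g≋h n = trans (f≋g n) (g≋h n)

module _ {f f′ g g′ : PS} (f≋f′ : f ≋ f′) (g≋g′ : g ≋ g′) where

  ⊕-cong : (f ⊕ g) ≋ (f′ ⊕ g′)
  ⊕-cong n = cong₂ ℤ._+_ (f≋f′ n) (g≋g′ n)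

  conv-cong : ∀ i m → conv f g i m ≡ conv f′ g′ i m
  conv-cong zero    m = cong₂ ℤ._*_ (f≋f′ 0) (g≋g′ m)
  conv-cong (suc i) m = cong₂ ℤ._+_ (cong₂ ℤ._*_ (f≋f′ (suc i)) (g≋g′ m)) (conv-cong i (suc m))

  ⊗-cong : (f ⊗ g) ≋ (f′ ⊗ g′)
  ⊗-cong n = conv-cong n 0

conv-shiftʳ : ∀ f g i m → conv f g i (suc m) ≡ conv f (shift g) i m
conv-shiftʳ f g zero    m = refl
conv-shiftʳ f g (suc i) m = cong (ℤ._+_ (f (suc i) ℤ.* g (suc m))) (conv-shiftʳ f g i (suc m))

conv-shiftˡ : ∀ f g i m → conv f g (suc i) m ≡ f 0 ℤ.* g (suc i + m) ℤ.+ conv (shift f) g i m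
conv-shiftˡ f g zero    m = ℤP.+-comm (f 1 ℤ.* g m) (f 0 ℤ.* g (suc m))
conv-shiftˡ f g (suc i) m = begin
    f (suc (suc i)) ℤ.* g m ℤ.+ conv f g (suc i) (suc m)
  ≡⟨ cong (ℤ._+_ (f (suc (suc i)) ℤ.* g m)) (conv-shiftˡ f g i (suc m)) ⟩
    f (suc (suc i)) ℤ.* g m ℤ.+ (f 0 ℤ.* g (suc i + suc m) ℤ.+ conv (shift f) g i (suc m))
  ≡⟨ cong (λ j → f (suc (suc i)) ℤ.* g m ℤ.+ (f 0 ℤ.* g j ℤ.+ conv (shift f) g i (suc m)))
          (ℕP.+-suc (suc i) m) ⟩
    f (suc (suc i)) ℤ.* g m ℤ.+ (f 0 ℤ.* g (suc (suc i) + m) ℤ.+ conv (shift f) g i (suc m))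
  ≡⟨ +-swap (f (suc (suc i)) ℤ.* g m) (f 0 ℤ.* g (suc (suc i) + m)) (conv (shift f) g i (suc m)) ⟩
    f 0 ℤ.* g (suc (suc i) + m) ℤ.+ conv (shift f) g (suc i) m ∎
  where
  open ≡-Reasoning
  +-swap : ∀ (a b c : ℤ) → a ℤ.+ (b ℤ.+ c) ≡ b ℤ.+ (a ℤ.+ c)
  +-swap = solve-∀

⊗-suc : ∀ f g n → (f ⊗ g) (suc n) ≡ f 0 ℤ.* g (suc n) ℤ.+ (shift f ⊗ g) n
⊗-suc f g n = trans (conv-shiftˡ f g n 0)
                    (cong (λ j → f 0 ℤ.* g j ℤ.+ (shift f ⊗ g) n) (ℕP.+-identityʳ (suc n)))

⊗-sucʳ : ∀ f g n → (f ⊗ g) (suc n) ≡ f (suc n) ℤ.* g 0 ℤ.+ (f ⊗ shift g) n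
⊗-sucʳ f g n = cong (ℤ._+_ (f (suc n) ℤ.* g 0)) (conv-shiftʳ f g n 0)

⊗-comm : ∀ f g → (f ⊗ g) ≋ (g ⊗ f)
⊗-comm f g zero    = ℤP.*-comm (f 0) (g 0)
⊗-comm f g (suc n) = begin
    (f ⊗ g) (suc n)
  ≡⟨ ⊗-suc f g n ⟩
    f 0 ℤ.* g (suc n) ℤ.+ (shift f ⊗ g) n
  ≡⟨ cong₂ ℤ._+_ (ℤP.*-comm (f 0) (g (suc n))) (⊗-comm (shift f) g n) ⟩
    g (suc n) ℤ.* f 0 ℤ.+ (g ⊗ shift f) n
  ≡⟨ sym (⊗-sucʳ g f n) ⟩
    (g ⊗ f) (suc n) ∎
  where open ≡-Reasoning

conv-zeroˡ : ∀ g i m → conv 0ps g i m ≡ + 0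
conv-zeroˡ g zero    m = refl
conv-zeroˡ g (suc i) m = trans (ℤP.+-identityˡ _) (conv-zeroˡ g i (suc m))

conv-zeroʳ : ∀ f i m → conv f 0ps i m ≡ + 0
conv-zeroʳ f zero    m = ℤP.*-zeroʳ (f 0)
conv-zeroʳ f (suc i) m = cong₂ ℤ._+_ (ℤP.*-zeroʳ (f (suc i))) (conv-zeroʳ f i (suc m))

conv-distribʳ : ∀ f f′ g i m → conv (f ⊕ f′) g i m ≡ conv f g i m ℤ.+ conv f′ g i m
conv-distribʳ f f′ g zero    m = ℤP.*-distribʳ-+ (g m) (f 0) (f′ 0)
conv-distribʳ f f′ g (suc i) m =
  trans (cong (ℤ._+_ ((f ⊕ f′) (suc i) ℤ.* g m)) (conv-distribʳ f f′ g i (suc m)))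
        (regroup (f (suc i)) (f′ (suc i)) (g m) (conv f g i (suc m)) (conv f′ g i (suc m)))
  where
  regroup : ∀ (a b c d e : ℤ) → (a ℤ.+ b) ℤ.* c ℤ.+ (d ℤ.+ e) ≡ (a ℤ.* c ℤ.+ d) ℤ.+ (b ℤ.* c ℤ.+ e)
  regroup = solve-∀

conv-distribˡ : ∀ f g g′ i m → conv f (g ⊕ g′) i m ≡ conv f g i m ℤ.+ conv f g′ i m
conv-distribˡ f g g′ zero    m = ℤP.*-distribˡ-+ (f 0) (g m) (g′ m)
conv-distribˡ f g g′ (suc i) m =
  trans (cong (ℤ._+_ (f (suc i) ℤ.* (g ⊕ g′) m)) (conv-distribˡ f g g′ i (suc m)))
        (regroup (f (suc i)) (g m) (g′ m) (conv f g i (suc m)) (conv f g′ i (suc m)))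
  where
  regroup : ∀ (a b c d e : ℤ) → a ℤ.* (b ℤ.+ c) ℤ.+ (d ℤ.+ e) ≡ (a ℤ.* b ℤ.+ d) ℤ.+ (a ℤ.* c ℤ.+ e)
  regroup = solve-∀

conv-scaleˡ : ∀ c f g i m → conv (λ n → c ℤ.* f n) g i m ≡ c ℤ.* conv f g i m
conv-scaleˡ c f g zero    m = ℤP.*-assoc c (f 0) (g m)
conv-scaleˡ c f g (suc i) m =
  trans (cong (ℤ._+_ ((c ℤ.* f (suc i)) ℤ.* g m)) (conv-scaleˡ c f g i (suc m)))
        (factor c (f (suc i)) (g m) (conv f g i (suc m)))
  where
  factor : ∀ (a b c d : ℤ) → (a ℤ.* b) ℤ.* c ℤ.+ a ℤ.* d ≡ a ℤ.* (b ℤ.* c ℤ.+ d)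
  factor = solve-∀

⊗-assoc : ∀ f g h → ((f ⊗ g) ⊗ h) ≋ (f ⊗ (g ⊗ h))
⊗-assoc f g h zero    = ℤP.*-assoc (f 0) (g 0) (h 0)
⊗-assoc f g h (suc n) = begin
    ((f ⊗ g) ⊗ h) (suc n)
  ≡⟨ ⊗-suc (f ⊗ g) h n ⟩
    (f 0 ℤ.* g 0) ℤ.* h (suc n) ℤ.+ (shift (f ⊗ g) ⊗ h) n
  ≡⟨ cong (ℤ._+_ fgh₀) (⊗-cong (⊗-suc f g) (λ _ → refl) n) ⟩
    (f 0 ℤ.* g 0) ℤ.* h (suc n) ℤ.+ (((λ m → f 0 ℤ.* (shift g) m) ⊕ (shift f ⊗ g)) ⊗ h) n
  ≡⟨ cong (ℤ._+_ fgh₀) (conv-distribʳ _ (shift f ⊗ g) h n 0) ⟩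
    (f 0 ℤ.* g 0) ℤ.* h (suc n) ℤ.+ (conv (λ m → f 0 ℤ.* shift g m) h n 0 ℤ.+ ((shift f ⊗ g) ⊗ h) n)
  ≡⟨ cong (ℤ._+_ fgh₀) (cong₂ ℤ._+_ (conv-scaleˡ (f 0) (shift g) h n 0) (⊗-assoc (shift f) g h n)) ⟩
    (f 0 ℤ.* g 0) ℤ.* h (suc n) ℤ.+ (f 0 ℤ.* (shift g ⊗ h) n ℤ.+ (shift f ⊗ (g ⊗ h)) n)
  ≡⟨ factor (f 0) (g 0) (h (suc n)) ((shift g ⊗ h) n) ((shift f ⊗ (g ⊗ h)) n) ⟩
    f 0 ℤ.* (g 0 ℤ.* h (suc n) ℤ.+ (shift g ⊗ h) n) ℤ.+ (shift f ⊗ (g ⊗ h)) n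
  ≡⟨ cong (λ x → f 0 ℤ.* x ℤ.+ (shift f ⊗ (g ⊗ h)) n) (sym (⊗-suc g h n)) ⟩
    f 0 ℤ.* (g ⊗ h) (suc n) ℤ.+ (shift f ⊗ (g ⊗ h)) n
  ≡⟨ sym (⊗-suc f (g ⊗ h) n) ⟩
    (f ⊗ (g ⊗ h)) (suc n) ∎
  where
  open ≡-Reasoning
  fgh₀ : ℤ
  fgh₀ = (f 0 ℤ.* g 0) ℤ.* h (suc n)
  factor : ∀ (a b c x y : ℤ) → (a ℤ.* b) ℤ.* c ℤ.+ (a ℤ.* x ℤ.+ y) ≡ a ℤ.* (b ℤ.* c ℤ.+ x) ℤ.+ y
  factor = solve-∀

⊗-identityʳ : ∀ f → (f ⊗ 1ps) ≋ f
⊗-identityʳ f zero    = ℤP.*-identityʳ (f 0)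
⊗-identityʳ f (suc n) = begin
    f (suc n) ℤ.* + 1 ℤ.+ conv f 1ps n 1
  ≡⟨ cong₂ ℤ._+_ (ℤP.*-identityʳ (f (suc n))) (trans (conv-shiftʳ f 1ps n 0) (conv-zeroʳ f n 0)) ⟩
    f (suc n) ℤ.+ + 0
  ≡⟨ ℤP.+-identityʳ (f (suc n)) ⟩
    f (suc n) ∎
  where open ≡-Reasoning

⊗-swap : ∀ f g h → (f ⊗ (g ⊗ h)) ≋ (g ⊗ (f ⊗ h))
⊗-swap f g h = ≋-trans (≋-sym (⊗-assoc f g h))
                       (≋-trans (⊗-cong (⊗-comm f g) (≋-refl {h})) (⊗-assoc g f h))

ΣPS-cong : ∀ s {F G : Fin s → PS} → (∀ i → F i ≋ G i) → ΣPS s F ≋ ΣPS s G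
ΣPS-cong zero    F≋G = λ _ → refl
ΣPS-cong (suc s) F≋G = ⊕-cong (F≋G zero) (ΣPS-cong s (F≋G ∘ suc))

⊗-distribˡ-ΣPS : ∀ s c (F : Fin s → PS) → ΣPS s (λ j → c ⊗ F j) ≋ (c ⊗ ΣPS s F)
⊗-distribˡ-ΣPS zero    c F n = sym (conv-zeroʳ c n 0)
⊗-distribˡ-ΣPS (suc s) c F n =
  trans (cong (ℤ._+_ ((c ⊗ F zero) n)) (⊗-distribˡ-ΣPS s c (F ∘ suc) n))
        (sym (conv-distribˡ c (F zero) (ΣPS s (F ∘ suc)) n 0))

blockStep : ℕ → PS → PS → PS
blockStep k A R = A ⊕ (((kx-1 k ⊗ A) ⊕ 1ps) ⊗ R)

blockStep-cong : ∀ k {A A′ R R′} → A ≋ A′ → R ≋ R′ → blockStep k A R ≋ blockStep k A′ R′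
blockStep-cong k A≋A′ R≋R′ =
  ⊕-cong A≋A′ (⊗-cong (⊕-cong (⊗-cong (λ _ → refl) A≋A′) (λ _ → refl)) R≋R′)

RHS-suc : ∀ k s (B : Fin (suc s) → PS) → RHS k (suc s) B ≋ blockStep k (B zero) (RHS k s (B ∘ suc))
RHS-suc k s B = ⊕-cong (⊗-identityʳ (B zero))
  (≋-trans (ΣPS-cong s λ j → ⊗-swap (B (suc j)) C _) (⊗-distribˡ-ΣPS s C _))
  where
  C : PS
  C = (kx-1 k ⊗ B zero) ⊕ 1ps

shift-kx-1-⊗ : ∀ k f m → (shift (kx-1 k) ⊗ f) m ≡ + k ℤ.* f m
shift-kx-1-⊗ k f zero    = refl
shift-kx-1-⊗ k f (suc m) =
  trans (⊗-suc (shift (kx-1 k)) f m)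
        (trans (cong (ℤ._+_ (+ k ℤ.* f (suc m))) (conv-zeroˡ f m 0)) (ℤP.+-identityʳ (+ k ℤ.* f (suc m))))

recurrence-GF : ∀ k (b c : ℕ → ℕ) → c 0 ≡ 0 → b 0 ≡ 1 → (∀ m → c (suc m) + b (suc m) ≡ b m * k) →
  GF c ≋ ((kx-1 k ⊗ GF b) ⊕ 1ps)
recurrence-GF k b c c0≡0 b0≡1 rec zero rewrite c0≡0 | b0≡1 = refl
recurrence-GF k b c c0≡0 b0≡1 rec (suc m) = begin
    + c (suc m)
  ≡⟨ solve (+ c (suc m)) (+ b (suc m)) ⟩
    (ℤ.- (+ 1) ℤ.* + b (suc m) ℤ.+ (+ c (suc m) ℤ.+ + b (suc m))) ℤ.+ + 0
  ≡⟨ cong (λ x → (ℤ.- (+ 1) ℤ.* + b (suc m) ℤ.+ x) ℤ.+ + 0) kb ⟩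
    (ℤ.- (+ 1) ℤ.* + b (suc m) ℤ.+ (shift (kx-1 k) ⊗ GF b) m) ℤ.+ + 0
  ≡⟨ cong (ℤ._+ + 0) (sym (⊗-suc (kx-1 k) (GF b) m)) ⟩
    ((kx-1 k ⊗ GF b) ⊕ 1ps) (suc m) ∎
  where
  open ≡-Reasoning
  solve : ∀ (x y : ℤ) → x ≡ (ℤ.- (+ 1) ℤ.* y ℤ.+ (x ℤ.+ y)) ℤ.+ + 0
  solve = solve-∀
  kb : + c (suc m) ℤ.+ + b (suc m) ≡ (shift (kx-1 k) ⊗ GF b) m
  kb = begin
      + c (suc m) ℤ.+ + b (suc m)
    ≡⟨ sym (ℤP.pos-+ (c (suc m)) (b (suc m))) ⟩
      + (c (suc m) + b (suc m))
    ≡⟨ cong +_ (trans (rec m) (ℕP.*-comm (b m) k)) ⟩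
      + (k * b m)
    ≡⟨ ℤP.pos-* k (b m) ⟩
      + k ℤ.* + b m
    ≡⟨ sym (shift-kx-1-⊗ k (GF b) m) ⟩
      (shift (kx-1 k) ⊗ GF b) m ∎

GF-⊗ : ∀ f g n → (GF f ⊗ GF g) n ≡ + ∑< (suc n) (λ m → f m * g (n ∸ m))
GF-⊗ f g zero    = trans (sym (ℤP.pos-* (f 0) (g 0))) (cong +_ (sym (ℕP.+-identityʳ _)))
GF-⊗ f g (suc n) = begin
    (GF f ⊗ GF g) (suc n)
  ≡⟨ ⊗-suc (GF f) (GF g) n ⟩
    + f 0 ℤ.* + g (suc n) ℤ.+ (GF (f ∘ suc) ⊗ GF g) n
  ≡⟨ cong₂ ℤ._+_ (sym (ℤP.pos-* (f 0) (g (suc n)))) (GF-⊗ (f ∘ suc) g n) ⟩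
    + (f 0 * g (suc n)) ℤ.+ + ∑< (suc n) (λ m → f (suc m) * g (n ∸ m))
  ≡⟨ sym (ℤP.pos-+ (f 0 * g (suc n)) _) ⟩
    + ∑< (suc (suc n)) (λ m → f m * g (suc n ∸ m)) ∎
  where open ≡-Reasoning

drops : (ℕ → ℕ) → (ℕ → ℕ) → ℕ → ℕ
drops d g N = ∑< N λ m → (d m ∸ d (suc m)) * g (suc m)

drops-none : ∀ {d} → (∀ m → d m ≤ 1) → d Preserves _≤_ ⟶ _≥_ → ∀ g N → d N ≡ 1 → drops d g N ≡ 0
drops-none {d} d≤1 d-anti g N dN≡1 = ∑<-zero N λ m m<N →
  cong (λ x → x * g (suc m)) (cong₂ _∸_ (stays-1 (ℕP.<⇒≤ m<N)) (stays-1 m<N))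
  where
  stays-1 : ∀ {m} → m ≤ N → d m ≡ 1
  stays-1 m≤N = ℕP.≤-antisym (d≤1 _) (subst (_≤ d _) dN≡1 (d-anti m≤N))

drops-first : ∀ {d} → (∀ m → d m ≤ 1) → d Preserves _≤_ ⟶ _≥_ → ∀ N → d 0 ≡ 1 → d N ≡ 0 →
  Σ[ m ∈ ℕ ] d m ≡ 1 × d (suc m) ≡ 0 × ∀ g → drops d g N ≡ g (suc m)
drops-first d≤1 d-anti zero    d0≡1 dN≡0 = contradiction (trans (sym d0≡1) dN≡0) λ ()
drops-first {d} d≤1 d-anti (suc N) d0≡1 dN≡0 with ℕP.m≤n⇒m<n∨m≡n (d≤1 1)
... | inj₁ d1<1 = 0 , d0≡1 , d1≡0 , λ g → begin
    (d 0 ∸ d 1) * g 1 + drops (d ∘ suc) (g ∘ suc) N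
  ≡⟨ cong₂ _+_ (cong₂ (λ x y → (x ∸ y) * g 1) d0≡1 d1≡0) (rest-zero g) ⟩
    1 * g 1 + 0
  ≡⟨ trans (ℕP.+-identityʳ _) (ℕP.*-identityˡ _) ⟩
    g 1 ∎
  where
  open ≡-Reasoning
  d1≡0 : d 1 ≡ 0
  d1≡0 = ℕP.n<1⇒n≡0 d1<1
  stays-0 : ∀ m → d (suc m) ≡ 0
  stays-0 m = ℕP.n≤0⇒n≡0 (subst (d (suc m) ≤_) d1≡0 (d-anti (s≤s z≤n)))
  rest-zero : ∀ g → drops (d ∘ suc) (g ∘ suc) N ≡ 0
  rest-zero g = ∑<-zero N λ m _ →
    cong₂ (λ x y → (x ∸ y) * g (suc (suc m))) (stays-0 m) (stays-0 (suc m))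
... | inj₂ d1≡1 with drops-first (d≤1 ∘ suc) (d-anti ∘ s≤s) N d1≡1 dN≡0
...   | m , dm≡1 , dsm≡0 , drops≡ = suc m , dm≡1 , dsm≡0 , λ g →
  cong₂ _+_ (cong₂ (λ x y → (x ∸ y) * g 1) d0≡1 d1≡1) (drops≡ (g ∘ suc))

take-length-++ : ∀ (p q : List ℕ) → take (length p) (p ++ q) ≡ p
take-length-++ []      q = refl
take-length-++ (a ∷ p) q = cong (a ∷_) (take-length-++ p q)

drop-++ : ∀ m (p q : List ℕ) → m ≤ length p → drop m (p ++ q) ≡ drop m p ++ q
drop-++ zero    p       q _           = refl
drop-++ (suc m) (a ∷ p) q (s≤s m≤|p|) = drop-++ m p q m≤|p|

length-take≤ : ∀ {m} (w : List ℕ) → m ≤ length w → length (take m w) ≡ m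
length-take≤ {m} w m≤|w| = trans (List.length-take m w) (ℕP.m≤n⇒m⊓n≡m m≤|w|)

take-take≤ : ∀ {m n} (w : List ℕ) → m ≤ n → take m (take n w) ≡ take m w
take-take≤ {m} {n} w m≤n = trans (List.take-take m n w) (cong (λ i → take i w) (ℕP.m≤n⇒m⊓n≡m m≤n))

take-++-drop-take : ∀ {m n} (w : List ℕ) → m ≤ n → take m w ++ drop m (take n w) ≡ take n w
take-++-drop-take {m} {n} w m≤n =
  trans (cong (_++ drop m (take n w)) (sym (take-take≤ w m≤n))) (List.take++drop≡id m (take n w))

++-assoc₃ : ∀ (u f v q : List ℕ) → (u ++ f ++ v) ++ q ≡ u ++ f ++ v ++ q
++-assoc₃ u f v q = trans (List.++-assoc u (f ++ v) q) (cong (u ++_) (List.++-assoc f v q))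

Concat : (List ℕ → Set) → (List ℕ → Set) → List ℕ → Set
Concat P Q w = ∃₂ λ p q → w ≡ p ++ q × P p × Q q

AppendClosed : (List ℕ → Set) → Set
AppendClosed P = ∀ p q → P p → P (p ++ q)

PrependClosed : (List ℕ → Set) → Set
PrependClosed Q = ∀ p q → Q q → Q (p ++ q)

-- For α the avoidance indicator of C: 1 iff the first occurrence of C in u ends at its last letter.
firstHit : (List ℕ → ℕ) → List ℕ → ℕ
firstHit α u = α (take (length u ∸ 1) u) ∸ α u

-- Only the split right after the shortest prefix containing C contributes to the sum.
concatAvoider : (List ℕ → ℕ) → (List ℕ → ℕ) → List ℕ → ℕ
concatAvoider α β w = α w + ∑< (suc (length w)) λ m → firstHit α (take m w) * β (drop m w)

firstHit-take : ∀ α {m} (w : List ℕ) → suc m ≤ length w →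
  firstHit α (take (suc m) w) ≡ α (take m w) ∸ α (take (suc m) w)
firstHit-take α {m} w m<|w| = cong (λ u → α u ∸ α (take (suc m) w))
  (trans (cong (λ l → take (l ∸ 1) (take (suc m) w)) (length-take≤ w m<|w|))
         (take-take≤ w (ℕP.n≤1+n m)))

count-concatAvoider : ∀ k α β n →
  count k (concatAvoider α β) n
    ≡ count k α n + ∑< (suc n) λ m → count k (firstHit α) m * count k β (n ∸ m)
count-concatAvoider k α β n = begin
    count k (concatAvoider α β) n
  ≡⟨ count-+ k n α _ ⟩
    count k α n + count k (λ w → ∑< (suc (length w)) (h w)) n
  ≡⟨ cong (_+_ (count k α n)) (count-cong k n λ w (|w|≡n , _) → cong (λ l → ∑< (suc l) (h w)) |w|≡n) ⟩
    count k α n + count k (λ w → ∑< (suc n) (h w)) n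
  ≡⟨ cong (_+_ (count k α n)) (count-∑< k (suc n) n λ m w → h w m) ⟩
    count k α n + ∑< (suc n) (λ m → count k (λ w → h w m) n)
  ≡⟨ cong (_+_ (count k α n)) (∑<-cong (suc n) λ m m<sn → split m (ℕP.m+[n∸m]≡n (ℕP.≤-pred m<sn))) ⟩
    count k α n + ∑< (suc n) (λ m → count k (firstHit α) m * count k β (n ∸ m)) ∎
  where
  open ≡-Reasoning
  h : List ℕ → ℕ → ℕ
  h w m = firstHit α (take m w) * β (drop m w)
  split : ∀ m → m + (n ∸ m) ≡ n → count k (λ w → h w m) n ≡ count k (firstHit α) m * count k β (n ∸ m)
  split m eq = subst (λ l → count k (λ w → h w m) l ≡ count k (firstHit α) m * count k β (n ∸ m)) eq
                     (count-split k m (n ∸ m) (firstHit α) β)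

concatAvoider-GF : ∀ k α β →
  GF (count k (concatAvoider α β)) ≋ (GF (count k α) ⊕ (GF (count k (firstHit α)) ⊗ GF (count k β)))
concatAvoider-GF k α β n =
  trans (cong +_ (count-concatAvoider k α β n))
        (trans (ℤP.pos-+ (count k α n) _)
               (cong (ℤ._+_ (+ count k α n)) (sym (GF-⊗ (count k (firstHit α)) (count k β) n))))

module _ {k : ℕ} {C : List ℕ → Set} {α : List ℕ → ℕ}
         (C-append : AppendClosed C) (α-avoids : IndicatorOn k (¬_ ∘ C) α) where

  prefix-antitone : ∀ {w} → Word k w → (λ m → α (take m w)) Preserves _≤_ ⟶ _≥_
  prefix-antitone {w} w∈ {m} {n} m≤n with α-avoids (take m w) (take⁺ m w∈)
  ... | inj₁ (_ , αm≡1) = subst (α (take n w) ≤_) (sym αm≡1) (Indicator-≤1 (α-avoids _ (take⁺ n w∈)))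
  ... | inj₂ (¬¬Cm , _) = subst (_≤ α (take m w)) (sym αn≡0) z≤n
    where
    αn≡0 : α (take n w) ≡ 0
    αn≡0 = Indicator-no (α-avoids _ (take⁺ n w∈)) λ ¬Cn →
      ¬¬Cm λ Cm → ¬Cn (subst C (take-++-drop-take w m≤n) (C-append _ _ Cm))

  ¬Concat⇔ : ∀ {D} → PrependClosed D → ∀ {w m} → Word k w →
    α (take m w) ≡ 1 → α (take (suc m) w) ≡ 0 → (¬ D (drop (suc m) w)) ⇔ (¬ Concat C D w)
  ¬Concat⇔ {D} D-prepend {w} {m} w∈ αm≡1 αsm≡0 = mk⇔ to from
    where
    to : ¬ D (drop (suc m) w) → ¬ Concat C D w
    to ¬D (p , q , w≡pq , Cp , Dq) = ¬D (subst D (sym drop≡) (D-prepend _ q Dq))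
      where
      αp≡0 : α (take (length p) w) ≡ 0
      αp≡0 = Indicator-no (α-avoids _ (take⁺ (length p) w∈))
        λ ¬C → ¬C (subst C (sym (trans (cong (take (length p)) w≡pq) (take-length-++ p q))) Cp)
      m<|p| : suc m ≤ length p
      m<|p| = ℕP.≰⇒> λ |p|≤m → contradiction (subst₂ _≤_ αm≡1 αp≡0 (prefix-antitone w∈ |p|≤m)) λ ()
      drop≡ : drop (suc m) w ≡ drop (suc m) p ++ q
      drop≡ = trans (cong (drop (suc m)) w≡pq) (drop-++ (suc m) p q m<|p|)
    from : ¬ Concat C D w → ¬ D (drop (suc m) w)
    from ¬CD D-rest = Indicator-≡0⇒¬ (α-avoids _ (take⁺ (suc m) w∈)) αsm≡0 λ C-prefix →
      ¬CD (take (suc m) w , drop (suc m) w , sym (List.take++drop≡id (suc m) w) , C-prefix , D-rest)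

  concatAvoider-avoids : ∀ {D β} → ¬ C [] → PrependClosed D → IndicatorOn k (¬_ ∘ D) β →
    IndicatorOn k (¬_ ∘ Concat C D) (concatAvoider α β)
  concatAvoider-avoids {D} {β} ¬C[] D-prepend β-avoids w w∈ = by-cases (α-avoids w w∈)
    where
    d g : ℕ → ℕ
    d m = α (take m w)
    g m = β (drop m w)
    d≤1 : ∀ m → d m ≤ 1
    d≤1 m = Indicator-≤1 (α-avoids _ (take⁺ m w∈))
    d-whole : d (length w) ≡ α w
    d-whole = cong α (List.take-all (length w) w ℕP.≤-refl)
    sum≡drops : ∑< (suc (length w)) (λ m → firstHit α (take m w) * β (drop m w)) ≡ drops d g (length w)
    sum≡drops = cong₂ _+_ (cong (_* β w) (ℕP.n∸n≡0 (α [])))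
                          (∑<-cong (length w) λ m m<|w| → cong (_* g (suc m)) (firstHit-take α w m<|w|))
    by-cases : Indicator (¬ C w) (α w) → Indicator (¬ Concat C D w) (concatAvoider α β w)
    by-cases (inj₁ (¬Cw , αw≡1)) = inj₁ (¬Concat , cong₂ _+_ αw≡1
      (trans sum≡drops (drops-none d≤1 (prefix-antitone w∈) g (length w) (trans d-whole αw≡1))))
      where
      ¬Concat : ¬ Concat C D w
      ¬Concat (p , q , w≡pq , Cp , _) = ¬Cw (subst C (sym w≡pq) (C-append p q Cp))
    by-cases (inj₂ (_ , αw≡0))
      with drops-first d≤1 (prefix-antitone w∈) (length w) (Indicator-yes (α-avoids [] []) ¬C[])
                       (trans d-whole αw≡0)
    ... | m , dm≡1 , dsm≡0 , drops≡g =
      Indicator-⇔ (¬Concat⇔ D-prepend w∈ dm≡1 dsm≡0)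
        (subst (Indicator _) (sym (cong₂ _+_ αw≡0 (trans sum≡drops (drops≡g g))))
               (β-avoids _ (drop⁺ (suc m) w∈)))

  count-firstHit : ∀ m → count k (firstHit α) (suc m) + count k α (suc m) ≡ count k α m * k
  count-firstHit m = begin
      count k (firstHit α) (suc m) + count k α (suc m)
    ≡⟨ sym (count-+ k (suc m) (firstHit α) α) ⟩
      count k (λ u → firstHit α u + α u) (suc m)
    ≡⟨ count-cong k (suc m) pointwise ⟩
      count k (λ u → α (take m u) * 1) (suc m)
    ≡⟨ subst (λ l → count k (λ u → α (take m u) * 1) l ≡ count k α m * ∑< k (λ _ → 1))
             (ℕP.+-comm m 1) (count-split k m 1 α λ _ → 1) ⟩
      count k α m * ∑< k (λ _ → 1)
    ≡⟨ cong (count k α m *_) (trans (∑<-const k 1) (ℕP.*-identityʳ k)) ⟩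
      count k α m * k ∎
    where
    open ≡-Reasoning
    pointwise : ∀ u → InWords k (suc m) u → firstHit α u + α u ≡ α (take m u) * 1
    pointwise u (|u|≡sm , u∈) = begin
        α (take (length u ∸ 1) u) ∸ α u + α u
      ≡⟨ cong (λ l → α (take (l ∸ 1) u) ∸ α u + α u) |u|≡sm ⟩
        α (take m u) ∸ α u + α u
      ≡⟨ ℕP.m∸n+n≡m (subst (_≤ α (take m u)) (cong α whole) (prefix-antitone u∈ (ℕP.n≤1+n m))) ⟩
        α (take m u)
      ≡⟨ sym (ℕP.*-identityʳ _) ⟩
        α (take m u) * 1 ∎
      where
      whole : take (suc m) u ≡ u
      whole = List.take-all (suc m) u (ℕP.≤-reflexive |u|≡sm)

  firstHit-GF : ¬ C [] → GF (count k (firstHit α)) ≋ ((kx-1 k ⊗ GF (count k α)) ⊕ 1ps)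
  firstHit-GF ¬C[] = recurrence-GF k (count k α) (count k (firstHit α))
    (ℕP.n∸n≡0 (α [])) (Indicator-yes (α-avoids [] []) ¬C[]) count-firstHit

  concatAvoider-blockStep : ¬ C [] → ∀ β →
    GF (count k (concatAvoider α β)) ≋ blockStep k (GF (count k α)) (GF (count k β))
  concatAvoider-blockStep ¬C[] β =
    ≋-trans (concatAvoider-GF k α β)
            (⊕-cong (≋-refl {GF (count k α)}) (⊗-cong (firstHit-GF ¬C[]) (≋-refl {GF (count k β)})))

Contains-append : ∀ τ → AppendClosed (Contains τ)
Contains-append τ _ q (u , f , v , refl , f≅τ) = u , f , v ++ q , ++-assoc₃ u f v q , f≅τ

ContainsMulti-prepend : ∀ τs → PrependClosed (ContainsMulti τs)
ContainsMulti-prepend []       _ _ _ = tt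
ContainsMulti-prepend (τ ∷ τs) p _ (u , f , v , refl , f≅τ , rest) =
  p ++ u , f , v , sym (List.++-assoc p u (f ++ v)) , f≅τ , rest

¬Contains-[] : ∀ {τ} → τ ≢ [] → ¬ Contains τ []
¬Contains-[] {[]}    τ≢[] _ = τ≢[] refl
¬Contains-[] {_ ∷ _} _ (u , f , v , []≡ufv , |f|≡|τ| , _) =
  ℕP.0≢1+n (trans (sym (cong length f≡[])) |f|≡|τ|)
  where
  f≡[] : f ≡ []
  f≡[] = List.++-conicalˡ f v (List.++-conicalʳ u (f ++ v) (sym []≡ufv))

Concat⇔ContainsMulti : ∀ τ τs w → Concat (Contains τ) (ContainsMulti τs) w ⇔ ContainsMulti (τ ∷ τs) w
Concat⇔ContainsMulti τ τs w = mk⇔ from to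
  where
  from : Concat (Contains τ) (ContainsMulti τs) w → ContainsMulti (τ ∷ τs) w
  from (_ , q , w≡pq , (u , f , v , refl , f≅τ) , rest) =
    u , f , v ++ q , trans w≡pq (++-assoc₃ u f v q) , f≅τ , ContainsMulti-prepend τs v q rest
  to : ContainsMulti (τ ∷ τs) w → Concat (Contains τ) (ContainsMulti τs) w
  to (u , f , v , w≡ufv , f≅τ , rest) =
    u ++ f , v , trans w≡ufv (sym (List.++-assoc u f v)) ,
    (u , f , [] , cong (u ++_) (sym (List.++-identityʳ f)) , f≅τ) , rest

multiAvoider : ∀ k s (τ : Fin s → List ℕ) → (∀ i → τ i ≢ []) → (b : Fin s → ℕ → ℕ) →
  (∀ i n → IsCount (λ w → ¬ Contains (τ i) w) k n (b i n)) →
  Σ[ χ ∈ (List ℕ → ℕ) ] IndicatorOn k (¬_ ∘ ContainsMulti (toList τ)) χ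
                       × GF (count k χ) ≋ RHS k s (λ i → GF (b i))
multiAvoider k zero    τ _    b _ = (λ _ → 0) , (λ _ _ → inj₂ ((λ avoids → avoids tt) , refl)) ,
                                    λ n → cong +_ (count-zero k n)
multiAvoider k (suc s) τ τ≢[] b counts
  with IsCount⇒IndicatorOn k (counts zero)
     | multiAvoider k s (τ ∘ suc) (τ≢[] ∘ suc) (b ∘ suc) (counts ∘ suc)
... | α , α-avoids , count-α | χ , χ-avoids , χ-GF = concatAvoider α χ , avoids , GF-RHS
  where
  ¬τ₀[] : ¬ Contains (τ zero) []
  ¬τ₀[] = ¬Contains-[] (τ≢[] zero)
  avoids : IndicatorOn k (¬_ ∘ ContainsMulti (toList τ)) (concatAvoider α χ)
  avoids w w∈ = Indicator-⇔ (¬-cong-⇔ (Concat⇔ContainsMulti (τ zero) (toList (τ ∘ suc)) w))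
    (concatAvoider-avoids (Contains-append (τ zero)) α-avoids ¬τ₀[] (ContainsMulti-prepend _) χ-avoids w w∈)
  GF-RHS : GF (count k (concatAvoider α χ)) ≋ RHS k (suc s) (λ i → GF (b i))
  GF-RHS = ≋-trans (concatAvoider-blockStep (Contains-append (τ zero)) α-avoids ¬τ₀[] χ)
          (≋-trans (blockStep-cong k (cong +_ ∘ count-α) χ-GF)
                   (≋-sym (RHS-suc k s λ i → GF (b i))))

-- The identity holds for every k and s; of the blocks only non-emptiness is used.
mainTheorem12 : (k s : ℕ) → 1 ≤ k → 1 ≤ s →
    (τ : Fin s → List ℕ) →
    (∀ i → IsPattern (τ i)) → (∀ i → ¬ (τ i ≡ [])) →
    (a : ℕ → ℕ) → (∀ n → IsCount (λ w → ¬ ContainsMulti (toList τ) w) k n (a n)) →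
    (b : Fin s → ℕ → ℕ) → (∀ i n → IsCount (λ w → ¬ Contains (τ i) w) k n (b i n)) →
    GF a ≋ RHS k s (λ i → GF (b i))
mainTheorem12 k s _ _ τ _ τ≢[] a counts-a b counts-b n with multiAvoider k s τ τ≢[] b counts-b
... | χ , χ-avoids , χ-GF =
  trans (cong +_ (sym (count-Indicator k (counts-a n) λ w w∈ → χ-avoids w (proj₂ w∈)))) (χ-GF n)
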